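{- For every integer $h\geq 2$ there exists $N_0(h)$, depending only on $h$, such that for every integer $N>N_0(h)$ there exists a positive integer $n$ with the following two properties: (i) $n$ is the sum of $N$ distinct, pairwise non-adjacent Fibonacci numbers; (ii) $n^h$ is the sum of at most $130h^2$ Fibonacci numbers.
   Context: The Fibonacci numbers are $F_0=0$, $F_1=1$, $F_{j+1}=F_j+F_{j-1}$; sums of "distinct non-adjacent Fibonacci numbers" refer to sums $\sum \varepsilon_j F_j$ over indices $j\geq 2$ with $\varepsilon_j\in\{0,1\}$ and no two consecutive indices both used (Zeckendorf expansions). -}

module Defs where

open import Data.Nat using (ℕ; zero; suc; _+_; _<_; _≤_)
open import Data.List using (List; map; length)
open import Data.Nat.ListAction using (sum)
open import Relation.Binary.PropositionalEquality using (_≡_)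
open import Data.List.Relation.Unary.All using (All)
open import Data.List.Relation.Unary.Linked using (Linked)
open import Data.Product using (Σ; _×_)

fib : ℕ → ℕ
fib zero = 0
fib (suc zero) = 1
fib (suc (suc j)) = fib (suc j) + fib j

NonAdj : ℕ → ℕ → Set
NonAdj i j = suc i < j

ZeckSumOf : ℕ → ℕ → Set
ZeckSumOf N n =
  Σ (List ℕ) λ is →
    All (2 ≤_) is × Linked NonAdj is × length is ≡ N × sum (map fib is) ≡ n

FibSumAtMost : ℕ → ℕ → Set
FibSumAtMost K m =
  Σ (List ℕ) λ is → length is ≤ K × sum (map fib is) ≡ m

-- Take k = 2q and n + 1 = L_{3k} + L_{2k} + 2 L_k, where n has a Zeckendorf expansion with q + 3
-- terms: a telescoping run F_2 + F_4 + … + F_{2q−4} = F_{2q−3} − 1 followed by five large terms.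
-- Since L_{ki} L_{kj} = L_{k(i+j)} + L_{k|i−j|}, each power n^h (h ≥ 2) is a constant plus a sum of
-- L_{kj} with j ≤ 3h and multiplicities below 7^h. Writing every multiplicity in base L_{2i}
-- (i = 3h + 1, digits at most 2) and using L_{2t} L_m = L_{m+2t} + L_{m−2t}, L_m = F_{m−1} + F_{m+1},
-- each of the 3h + 1 groups costs O(h) Fibonacci numbers, O(h²) in total.
module Submission where

open import Defs
open import Data.Nat
open import Data.Nat.Properties
open import Data.List using (List; []; _∷_; _++_; map; length; iterate; replicate)
open import Data.List.Properties using (length-++; map-++; length-iterate)
open import Data.Nat.ListAction using (sum)
open import Data.Nat.ListAction.Properties using (sum-++)
open import Data.List.Relation.Unary.All as All using (All)
open import Data.List.Relation.Unary.All.Properties using (++⁺)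
open import Data.List.Relation.Unary.Linked as Linked using (Linked)
open import Data.Product using (_×_; _,_; proj₁; proj₂; Σ)
open import Data.Sum using (inj₁; inj₂)
open import Relation.Binary.PropositionalEquality
open import Relation.Nullary.Decidable using (True; toWitness)
open import Data.Unit using (tt)
open import Relation.Nullary.Negation using (contradiction)
open import Data.Nat.DivMod using (_/_; _%_; m≡m%n+[m/n]*n; m%n<n; m<n*o⇒m/o<n)
open import Data.Nat.Tactic.RingSolver
open import Algebra.Properties.CommutativeSemigroup +-commutativeSemigroup
  using () renaming (interchange to +-interchange)
open ≡-Reasoning

-- Lucas numbers

-- Opaque, so that the proofs reason about lucas only through the equations below.
opaque
  lucas : ℕ → ℕ
  lucas zero = 2
  lucas (suc n) = fib n + fib (suc (suc n))

  lucas-0 : lucas 0 ≡ 2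
  lucas-0 = refl

  lucas-1 : lucas 1 ≡ 1
  lucas-1 = refl

  lucas-suc : ∀ n → lucas (suc n) ≡ fib n + fib (suc (suc n))
  lucas-suc n = refl

  lucas-suc-suc : ∀ n → lucas (2 + n) ≡ lucas (1 + n) + lucas n
  lucas-suc-suc zero = refl
  lucas-suc-suc (suc n) with fib n | fib (suc n)
  ... | a | b = solve (a ∷ b ∷ [])

lucas-2 : lucas 2 ≡ 3
lucas-2 rewrite lucas-suc-suc 0 | lucas-0 | lucas-1 = refl

suc+suc : ∀ b → suc b + suc b ≡ 2 + (b + b)
suc+suc b = cong suc (+-suc b b)

-- The identities L_b² = L_{2b} + 2(−1)^b, L_{b+1} L_b = L_{2b+1} + (−1)^b and
-- L_{b+1}² = L_{2b+2} − 2(−1)^b, split by the parity of b to stay in ℕ.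
DoublingEven : ℕ → Set
DoublingEven b = (lucas b * lucas b ≡ lucas (b + b) + 2)
               × (lucas (1 + b) * lucas b ≡ lucas (1 + (b + b)) + 1)
               × (lucas (1 + b) * lucas (1 + b) + 2 ≡ lucas (2 + (b + b)))

DoublingOdd : ℕ → Set
DoublingOdd b = (lucas b * lucas b + 2 ≡ lucas (b + b))
              × (lucas (1 + b) * lucas b + 1 ≡ lucas (1 + (b + b)))
              × (lucas (1 + b) * lucas (1 + b) ≡ lucas (2 + (b + b)) + 2)

-- With x = L_{b+1}, y = L_b, l₀ = L_{2b}, l₁ = L_{2b+1}, the recurrence gives L_{b+2} = x + y,
-- L_{2b+2} = l₁ + l₀, L_{2b+3} = (l₁ + l₀) + l₁, L_{2b+4} = ((l₁ + l₀) + l₁) + (l₁ + l₀).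
module DoublingStep (x y l₀ l₁ : ℕ) where

  even⇒odd : y * y ≡ l₀ + 2 → x * y ≡ l₁ + 1 → x * x + 2 ≡ l₁ + l₀ →
             ((x + y) * x + 1 ≡ (l₁ + l₀) + l₁)
           × ((x + y) * (x + y) ≡ ((l₁ + l₀) + l₁) + (l₁ + l₀) + 2)
  even⇒odd yy xy xx = product , square
    where
    product = begin
      (x + y) * x + 1       ≡⟨ solve (x ∷ y ∷ []) ⟩
      x * x + 1 + x * y     ≡⟨ cong (x * x + 1 +_) xy ⟩
      x * x + 1 + (l₁ + 1)  ≡⟨ solve (x ∷ l₁ ∷ []) ⟩
      (x * x + 2) + l₁      ≡⟨ cong (_+ l₁) xx ⟩
      (l₁ + l₀) + l₁        ∎
    square = begin
      (x + y) * (x + y)                ≡⟨ solve (x ∷ y ∷ []) ⟩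
      x * x + 2 * (x * y) + y * y      ≡⟨ cong₂ (λ u v → x * x + 2 * u + v) xy yy ⟩
      x * x + 2 * (l₁ + 1) + (l₀ + 2)  ≡⟨ solve (x ∷ l₀ ∷ l₁ ∷ []) ⟩
      (x * x + 2) + (l₁ + l₁ + l₀ + 2) ≡⟨ cong (_+ (l₁ + l₁ + l₀ + 2)) xx ⟩
      (l₁ + l₀) + (l₁ + l₁ + l₀ + 2)   ≡⟨ solve (l₀ ∷ l₁ ∷ []) ⟩
      ((l₁ + l₀) + l₁) + (l₁ + l₀) + 2 ∎

  odd⇒even : y * y + 2 ≡ l₀ → x * y + 1 ≡ l₁ → x * x ≡ (l₁ + l₀) + 2 →
             ((x + y) * x ≡ (l₁ + l₀) + l₁ + 1)
           × ((x + y) * (x + y) + 2 ≡ ((l₁ + l₀) + l₁) + (l₁ + l₀))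
  odd⇒even yy xy xx = product , square
    where
    product = begin
      (x + y) * x                  ≡⟨ solve (x ∷ y ∷ []) ⟩
      x * x + x * y                ≡⟨ cong (_+ x * y) xx ⟩
      (l₁ + l₀) + 2 + x * y        ≡⟨ solve (l₀ ∷ l₁ ∷ x ∷ y ∷ []) ⟩
      (l₁ + l₀) + (x * y + 1) + 1  ≡⟨ cong (λ u → (l₁ + l₀) + u + 1) xy ⟩
      (l₁ + l₀) + l₁ + 1           ∎
    square = begin
      (x + y) * (x + y) + 2                             ≡⟨ solve (x ∷ y ∷ []) ⟩
      x * x + 2 * (x * y) + y * y + 2                   ≡⟨ cong (λ u → u + 2 * (x * y) + y * y + 2) xx ⟩
      (l₁ + l₀) + 2 + 2 * (x * y) + y * y + 2           ≡⟨ solve (l₀ ∷ l₁ ∷ x ∷ y ∷ []) ⟩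
      l₁ + (x * y + 1) + (x * y + 1) + l₀ + (y * y + 2) ≡⟨ cong₂ (λ u v → l₁ + u + u + l₀ + v) xy yy ⟩
      l₁ + l₁ + l₁ + l₀ + l₀                            ≡⟨ solve (l₀ ∷ l₁ ∷ []) ⟩
      ((l₁ + l₀) + l₁) + (l₁ + l₀)                      ∎

doublingOdd-suc : ∀ b → DoublingEven b → DoublingOdd (suc b)
doublingOdd-suc b (yy , xy , xx)
  rewrite suc+suc b | lucas-suc-suc b | lucas-suc-suc (2 + (b + b))
        | lucas-suc-suc (1 + (b + b)) | lucas-suc-suc (b + b)
  = xx , DoublingStep.even⇒odd (lucas (1 + b)) (lucas b) (lucas (b + b)) (lucas (1 + (b + b))) yy xy xx

doublingEven-suc : ∀ b → DoublingOdd b → DoublingEven (suc b)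
doublingEven-suc b (yy , xy , xx)
  rewrite suc+suc b | lucas-suc-suc b | lucas-suc-suc (2 + (b + b))
        | lucas-suc-suc (1 + (b + b)) | lucas-suc-suc (b + b)
  = xx , DoublingStep.odd⇒even (lucas (1 + b)) (lucas b) (lucas (b + b)) (lucas (1 + (b + b))) yy xy xx

doubling-even : ∀ t → DoublingEven (t + t)
doubling-even zero rewrite lucas-suc-suc 0 | lucas-0 | lucas-1 = refl , refl , refl
doubling-even (suc t) =
  subst DoublingEven (sym (suc+suc t)) (doublingEven-suc _ (doublingOdd-suc _ (doubling-even t)))

-- Both sides satisfy the Lucas recurrence in x; the cases x = 0, 1 are the first two doubling identities.
lucas-+-even : ∀ t x → lucas (x + (t + t) + (t + t)) + lucas x ≡ lucas (t + t) * lucas (x + (t + t))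
lucas-+-even t zero rewrite lucas-0 = begin
  lucas (t + t + (t + t)) + 2 ≡⟨ sym (proj₁ (doubling-even t)) ⟩
  lucas (t + t) * lucas (t + t) ∎
lucas-+-even t (suc zero) rewrite lucas-1 = begin
  lucas (1 + (t + t + (t + t))) + 1 ≡⟨ sym (proj₁ (proj₂ (doubling-even t))) ⟩
  lucas (1 + (t + t)) * lucas (t + t) ≡⟨ *-comm (lucas (1 + (t + t))) _ ⟩
  lucas (t + t) * lucas (1 + (t + t)) ∎
lucas-+-even t (suc (suc x)) = begin
  lucas (2 + (x + n + n)) + lucas (2 + x)
    ≡⟨ cong₂ _+_ (lucas-suc-suc (x + n + n)) (lucas-suc-suc x) ⟩
  (lucas (1 + (x + n + n)) + lucas (x + n + n)) + (lucas (1 + x) + lucas x)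
    ≡⟨ +-interchange (lucas (1 + (x + n + n))) _ _ _ ⟩
  (lucas (1 + (x + n + n)) + lucas (1 + x)) + (lucas (x + n + n) + lucas x)
    ≡⟨ cong₂ _+_ (lucas-+-even t (suc x)) (lucas-+-even t x) ⟩
  lucas n * lucas (1 + (x + n)) + lucas n * lucas (x + n)
    ≡⟨ sym (*-distribˡ-+ (lucas n) _ _) ⟩
  lucas n * (lucas (1 + (x + n)) + lucas (x + n))
    ≡⟨ cong (lucas n *_) (sym (lucas-suc-suc (x + n))) ⟩
  lucas n * lucas (2 + (x + n)) ∎
  where n = t + t

lucas-*-even : ∀ t m → t + t ≤ m → lucas (t + t) * lucas m ≡ lucas (m + (t + t)) + lucas (m ∸ (t + t))
lucas-*-even t m n≤m = begin
  lucas n * lucas m                     ≡⟨ cong (λ u → lucas n * lucas u) (sym m∸n+n) ⟩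
  lucas n * lucas (m ∸ n + n)           ≡⟨ sym (lucas-+-even t (m ∸ n)) ⟩
  lucas (m ∸ n + n + n) + lucas (m ∸ n) ≡⟨ cong (λ u → lucas (u + n) + lucas (m ∸ n)) m∸n+n ⟩
  lucas (m + n) + lucas (m ∸ n)         ∎
  where
  n = t + t
  m∸n+n : m ∸ n + n ≡ m
  m∸n+n = m∸n+n≡m n≤m

lucas-≤-suc : ∀ n → lucas (1 + n) ≤ lucas (2 + n)
lucas-≤-suc n rewrite lucas-suc-suc n = m≤m+n (lucas (1 + n)) (lucas n)

lucas-+2≤3* : ∀ t → lucas (2 + (t + t)) ≤ 3 * lucas (t + t)
lucas-+2≤3* zero rewrite lucas-2 | lucas-0 = s≤s (s≤s (s≤s z≤n))
lucas-+2≤3* (suc t) rewrite suc+suc t | lucas-suc-suc (2 + (t + t)) | lucas-suc-suc (1 + (t + t)) =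
  ≤-trans (+-monoˡ-≤ (lucas (2 + m)) (+-monoʳ-≤ (lucas (2 + m)) (lucas-≤-suc m)))
          (≤-reflexive (arith (lucas (2 + m))))
  where
  m = t + t
  arith : ∀ x → x + x + x ≡ 3 * x
  arith = solve-∀

2^≤lucas : ∀ t → 2 ^ t ≤ lucas (t + t)
2^≤lucas zero rewrite lucas-0 = s≤s z≤n
2^≤lucas (suc zero) rewrite lucas-2 = s≤s (s≤s z≤n)
2^≤lucas (suc (suc t)) =
  ≤-trans (*-monoʳ-≤ 2 (2^≤lucas (suc t)))
          (subst₂ (λ u v → 2 * lucas u ≤ lucas v)
                  (sym (suc+suc t)) (sym (trans (suc+suc (suc t)) (cong (2 +_) (suc+suc t))))
                  (double≤ (t + t)))
  where
  double≤ : ∀ m → 2 * lucas (2 + m) ≤ lucas (4 + m)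
  double≤ m rewrite lucas-suc-suc (2 + m) | +-identityʳ (lucas (2 + m)) =
    +-monoˡ-≤ (lucas (2 + m)) (lucas-≤-suc (1 + m))

-- Representations by few Fibonacci numbers

fibSum-0 : FibSumAtMost 0 0
fibSum-0 = [] , z≤n , refl

fibSum-+ : ∀ {a b x y} → FibSumAtMost a x → FibSumAtMost b y → FibSumAtMost (a + b) (x + y)
fibSum-+ (is , |is|≤a , Σis) (js , |js|≤b , Σjs) =
  is ++ js ,
  ≤-trans (≤-reflexive (length-++ is)) (+-mono-≤ |is|≤a |js|≤b) ,
  trans (cong sum (map-++ fib is js)) (trans (sum-++ (map fib is) (map fib js)) (cong₂ _+_ Σis Σjs))

fibSum-mono : ∀ {a b x} → a ≤ b → FibSumAtMost a x → FibSumAtMost b x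
fibSum-mono a≤b (is , |is|≤a , Σis) = is , ≤-trans |is|≤a a≤b , Σis

fibSum-* : ∀ d {a x} → FibSumAtMost a x → FibSumAtMost (d * a) (d * x)
fibSum-* zero _ = fibSum-0
fibSum-* (suc d) x-sum = fibSum-+ x-sum (fibSum-* d x-sum)

fibSum-lucas : ∀ m → FibSumAtMost 2 (lucas m)
fibSum-lucas zero = 1 ∷ 1 ∷ [] , ≤-refl , sym lucas-0
fibSum-lucas (suc m) =
  m ∷ 2 + m ∷ [] , ≤-refl , trans (cong (fib m +_) (+-identityʳ (fib (2 + m)))) (sym (lucas-suc m))

-- The base-L_{2i} expansion of c, whose digits are at most 2 by lucas-+2≤3*.
fibSum-digits : ∀ {v s w} i → FibSumAtMost s v → (∀ t → t < i → FibSumAtMost w (lucas (t + t) * v)) →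
                ∀ c → c < lucas (i + i) → FibSumAtMost (i * (2 * w) + s) (c * v)
fibSum-digits zero v-sum _ zero _ = fibSum-mono z≤n fibSum-0
fibSum-digits zero v-sum _ (suc zero) _ = subst (FibSumAtMost _) (sym (+-identityʳ _)) v-sum
fibSum-digits zero v-sum _ (suc (suc c)) c<L₀ =
  contradiction (subst (suc (suc c) <_) lucas-0 c<L₀) λ { (s≤s (s≤s ())) }
fibSum-digits {v} {s} {w} (suc i) v-sum blocks c c<L =
  subst (FibSumAtMost _) (sym c*v≡) (fibSum-mono bound (fibSum-+ high low))
  where
  T = lucas (i + i)
  instance
    T-nonZero : NonZero T
    T-nonZero = >-nonZero (≤-trans (m^n>0 2 i) (2^≤lucas i))
  d≤2 : c / T ≤ 2
  d≤2 = ≤-pred (m<n*o⇒m/o<n (≤-trans c<L (≤-trans (≤-reflexive (cong lucas (suc+suc i))) (lucas-+2≤3* i))))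
  high : FibSumAtMost (c / T * w) (c / T * (T * v))
  high = fibSum-* (c / T) (blocks i ≤-refl)
  low : FibSumAtMost (i * (2 * w) + s) (c % T * v)
  low = fibSum-digits i v-sum (λ t t<i → blocks t (m<n⇒m<1+n t<i)) (c % T) (m%n<n c T)
  bound : c / T * w + (i * (2 * w) + s) ≤ suc i * (2 * w) + s
  bound = ≤-trans (+-monoˡ-≤ _ (*-monoˡ-≤ w d≤2)) (≤-reflexive (sym (+-assoc (2 * w) _ s)))
  c*v≡ : c * v ≡ c / T * (T * v) + c % T * v
  c*v≡ = trans (cong (_* v) (m≡m%n+[m/n]*n c T)) (arith (c % T) (c / T) T v)
    where
    arith : ∀ r d T v → (r + d * T) * v ≡ d * (T * v) + r * v
    arith = solve-∀

fibSum-*lucas : ∀ i m → i + i ≤ m → ∀ c → c < lucas (i + i) → FibSumAtMost (i * 8 + 2) (c * lucas m)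
fibSum-*lucas i m 2i≤m = fibSum-digits i (fibSum-lucas m) blocks
  where
  blocks : ∀ t → t < i → FibSumAtMost 4 (lucas (t + t) * lucas m)
  blocks t t<i = subst (FibSumAtMost 4) (sym (lucas-*-even t m 2t≤m)) (fibSum-+ (fibSum-lucas _) (fibSum-lucas _))
    where
    2t≤m : t + t ≤ m
    2t≤m = ≤-trans (+-mono-≤ (<⇒≤ t<i) (<⇒≤ t<i)) 2i≤m

fibSum-< : ∀ i c → c < lucas (i + i) → FibSumAtMost (i * 4 + 1) c
fibSum-< i c c<L = subst (FibSumAtMost _) (*-identityʳ c) (fibSum-digits i (1 ∷ [] , ≤-refl , refl) blocks c c<L)
  where
  blocks : ∀ t → t < i → FibSumAtMost 2 (lucas (t + t) * 1)
  blocks t _ = subst (FibSumAtMost 2) (sym (*-identityʳ _)) (fibSum-lucas (t + t))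

-- Polynomials in the Lucas numbers L_{kj}

_⊙_ : ℕ → List ℕ → List ℕ
x ⊙ [] = []
x ⊙ (y ∷ ys) = x + y ∷ ∣ x - y ∣ ∷ x ⊙ ys

_⊠_ : List ℕ → List ℕ → List ℕ
[] ⊠ ys = []
(x ∷ xs) ⊠ ys = x ⊙ ys ++ xs ⊠ ys

copies : ℕ → List ℕ → List ℕ
copies zero M = []
copies (suc c) M = M ++ copies c M

-- (M , c) stands for c + Σ_{j ∈ M} L_{kj}; the product mirrors L_{ki} L_{kj} = L_{k(i+j)} + L_{k|i−j|}.
LucasPoly : Set
LucasPoly = List ℕ × ℕ

_⊗_ : LucasPoly → LucasPoly → LucasPoly
(M , c) ⊗ (M′ , c′) = M ⊠ M′ ++ copies c′ M ++ copies c M′ , c * c′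

-- Weighting each term by 2 (a product of two terms has two terms) makes size multiplicative.
size : LucasPoly → ℕ
size (M , c) = 2 * length M + c

length-⊙ : ∀ x ys → length (x ⊙ ys) ≡ 2 * length ys
length-⊙ x [] = refl
length-⊙ x (y ∷ ys) rewrite length-⊙ x ys = cong suc (sym (+-suc (length ys) (length ys + 0)))

length-⊠ : ∀ xs ys → length (xs ⊠ ys) ≡ 2 * (length xs * length ys)
length-⊠ [] ys = refl
length-⊠ (x ∷ xs) ys rewrite length-++ (x ⊙ ys) {xs ⊠ ys} | length-⊙ x ys | length-⊠ xs ys =
  sym (*-distribˡ-+ 2 (length ys) (length xs * length ys))

length-copies : ∀ c M → length (copies c M) ≡ c * length M
length-copies zero M = refl
length-copies (suc c) M rewrite length-++ M {copies c M} | length-copies c M = refl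

size-⊗ : ∀ p p′ → size (p ⊗ p′) ≡ size p * size p′
size-⊗ (M , c) (M′ , c′)
  rewrite length-++ (M ⊠ M′) {copies c′ M ++ copies c M′} | length-++ (copies c′ M) {copies c M′}
        | length-⊠ M M′ | length-copies c′ M | length-copies c M′ = arith (length M) (length M′) c c′
  where
  arith : ∀ a b c c′ → 2 * (2 * (a * b) + (c′ * a + c * b)) + c * c′ ≡ (2 * a + c) * (2 * b + c′)
  arith = solve-∀

⊙-bounded : ∀ {a b x ys} → x ≤ a → All (_≤ b) ys → All (_≤ a + b) (x ⊙ ys)
⊙-bounded x≤a All.[] = All.[]
⊙-bounded {x = x} {y ∷ _} x≤a (y≤b All.∷ ys≤b) =
  x+y≤a+b All.∷ ≤-trans (∣m-n∣≤m⊔n x y) (≤-trans (m⊔n≤m+n x y) x+y≤a+b) All.∷ ⊙-bounded x≤a ys≤b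
  where x+y≤a+b = +-mono-≤ x≤a y≤b

⊠-bounded : ∀ {a b xs ys} → All (_≤ a) xs → All (_≤ b) ys → All (_≤ a + b) (xs ⊠ ys)
⊠-bounded All.[] _ = All.[]
⊠-bounded (x≤a All.∷ xs≤a) ys≤b = ++⁺ (⊙-bounded x≤a ys≤b) (⊠-bounded xs≤a ys≤b)

copies-bounded : ∀ {a} c {M} → All (_≤ a) M → All (_≤ a) (copies c M)
copies-bounded zero _ = All.[]
copies-bounded (suc c) M≤a = ++⁺ M≤a (copies-bounded c M≤a)

⊗-bounded : ∀ {a b} p p′ → All (_≤ a) (proj₁ p) → All (_≤ b) (proj₁ p′) → All (_≤ a + b) (proj₁ (p ⊗ p′))
⊗-bounded {a} {b} (M , c) (M′ , c′) M≤a M′≤b =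
  ++⁺ (⊠-bounded M≤a M′≤b)
      (++⁺ (All.map (λ j≤a → ≤-trans j≤a (m≤m+n a b)) (copies-bounded c′ M≤a))
           (All.map (λ j≤b → ≤-trans j≤b (m≤n+m b a)) (copies-bounded c M′≤b)))

sumUpTo : (ℕ → ℕ) → ℕ → ℕ
sumUpTo f zero = f 0
sumUpTo f (suc D) = sumUpTo f D + f (suc D)

sumUpTo-cong : ∀ {f g} D → (∀ j → f j ≡ g j) → sumUpTo f D ≡ sumUpTo g D
sumUpTo-cong zero f≗g = f≗g 0
sumUpTo-cong (suc D) f≗g = cong₂ _+_ (sumUpTo-cong D f≗g) (f≗g (suc D))

sumUpTo-+ : ∀ f g D → sumUpTo (λ j → f j + g j) D ≡ sumUpTo f D + sumUpTo g D
sumUpTo-+ f g zero = refl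
sumUpTo-+ f g (suc D) rewrite sumUpTo-+ f g D =
  +-interchange (sumUpTo f D) (sumUpTo g D) (f (suc D)) (g (suc D))

fibSum-sumUpTo : ∀ {a b c} f D → FibSumAtMost b (f 0 + c) → (∀ j → FibSumAtMost a (f (suc j))) →
                 FibSumAtMost (D * a + b) (sumUpTo f D + c)
fibSum-sumUpTo f zero first _ = first
fibSum-sumUpTo {a} {b} {c} f (suc D) first rest =
  subst (FibSumAtMost _) (arith (sumUpTo f D) c (f (suc D)))
    (fibSum-mono (≤-reflexive (arith′ (D * a) b a)) (fibSum-+ (fibSum-sumUpTo f D first rest) (rest D)))
  where
  arith : ∀ x c y → x + c + y ≡ x + y + c
  arith = solve-∀
  arith′ : ∀ x b a → x + b + a ≡ a + x + b
  arith′ = solve-∀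

δ : ℕ → ℕ → ℕ
δ zero zero = 1
δ zero (suc j) = 0
δ (suc i) zero = 0
δ (suc i) (suc j) = δ i j

δ-refl : ∀ i → δ i i ≡ 1
δ-refl zero = refl
δ-refl (suc i) = δ-refl i

δ-< : ∀ {i j} → i < j → δ i j ≡ 0
δ-< {zero} {suc j} _ = refl
δ-< {suc i} {suc j} (s≤s i<j) = δ-< i<j

δ-> : ∀ {i j} → j < i → δ i j ≡ 0
δ-> {suc i} {zero} _ = refl
δ-> {suc i} {suc j} (s≤s j<i) = δ-> j<i

sumUpTo-δ-< : ∀ (a : ℕ → ℕ) {x} D → D < x → sumUpTo (λ j → δ j x * a j) D ≡ 0
sumUpTo-δ-< a zero 0<x rewrite δ-< 0<x = refl
sumUpTo-δ-< a (suc D) D<x rewrite sumUpTo-δ-< a D (<-trans (n<1+n D) D<x) | δ-< D<x = refl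

sumUpTo-δ : ∀ (a : ℕ → ℕ) {x} D → x ≤ D → sumUpTo (λ j → δ j x * a j) D ≡ a x
sumUpTo-δ a zero z≤n = +-identityʳ (a 0)
sumUpTo-δ a {x} (suc D) x≤1+D with m≤n⇒m<n∨m≡n x≤1+D
... | inj₁ x<1+D rewrite sumUpTo-δ a D (≤-pred x<1+D) | δ-> x<1+D = +-identityʳ (a x)
... | inj₂ refl rewrite sumUpTo-δ-< a D (n<1+n D) | δ-refl (suc D) = +-identityʳ (a (suc D))

multiplicity : ℕ → List ℕ → ℕ
multiplicity j [] = 0
multiplicity j (x ∷ xs) = δ j x + multiplicity j xs

multiplicity≤length : ∀ j M → multiplicity j M ≤ length M
multiplicity≤length j [] = z≤n
multiplicity≤length j (x ∷ xs) = +-mono-≤ (δ≤1 j x) (multiplicity≤length j xs)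
  where
  δ≤1 : ∀ i j → δ i j ≤ 1
  δ≤1 zero zero = ≤-refl
  δ≤1 zero (suc j) = z≤n
  δ≤1 (suc i) zero = z≤n
  δ≤1 (suc i) (suc j) = δ≤1 i j

-- n² = (n+1)² − 2(n+1) + 1 and n³ = (n+1)³ − 3(n+1)² + 3(n+1) − 1 with n + 1 = Σℓ base; the
-- expansions below are the multisets left after the cancellation, verified in square-identity
-- and cube-identity.
base : List ℕ
base = 3 ∷ 2 ∷ 1 ∷ 1 ∷ []

square-terms : List ℕ
square-terms = replicate 6 0 ++ replicate 2 1 ++ replicate 6 2 ++ replicate 2 3
            ++ replicate 5 4 ++ replicate 2 5 ++ replicate 1 6

cube-terms : List ℕ
cube-terms = replicate 5 0 ++ replicate 51 1 ++ replicate 24 2 ++ replicate 38 3 ++ replicate 12 4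
          ++ replicate 18 5 ++ replicate 10 6 ++ replicate 9 7 ++ replicate 3 8 ++ replicate 1 9

power : ℕ → LucasPoly
power zero = square-terms , 1
power (suc zero) = cube-terms , 1
power (suc (suc h)) = power 0 ⊗ power h

power-bounded : ∀ h → All (_≤ 3 * (2 + h)) (proj₁ (power h))
power-bounded zero = toWitness {a? = All.all? (_≤? 6) square-terms} tt
power-bounded (suc zero) = toWitness {a? = All.all? (_≤? 9) cube-terms} tt
power-bounded (suc (suc h)) =
  subst (λ b → All (_≤ b) (proj₁ (power (2 + h)))) (arith h) (⊗-bounded (power 0) (power h) (power-bounded 0) (power-bounded h))
  where
  arith : ∀ h → 6 + 3 * (2 + h) ≡ 3 * (4 + h)
  arith = solve-∀

size-power : ∀ h → size (power h) ≡ 7 ^ (2 + h)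
size-power zero = refl
size-power (suc zero) = refl
size-power (suc (suc h)) = begin
  size (power 0 ⊗ power h)        ≡⟨ size-⊗ (power 0) (power h) ⟩
  7 ^ 2 * size (power h)          ≡⟨ cong (7 ^ 2 *_) (size-power h) ⟩
  7 ^ 2 * 7 ^ (2 + h)             ≡⟨ sym (^-distribˡ-+-* 7 2 (2 + h)) ⟩
  7 ^ (4 + h)                     ∎

cancel-square : ∀ n w → (n + 1) * (n + 1) ≡ w + 2 * (n + 1) → n ^ 2 ≡ w + 1
cancel-square n w e = +-cancelˡ-≡ (2 * (n + 1)) (n ^ 2) (w + 1) (begin
  2 * (n + 1) + n * (n * 1) ≡⟨ solve (n ∷ []) ⟩
  (n + 1) * (n + 1) + 1   ≡⟨ cong (_+ 1) e ⟩
  w + 2 * (n + 1) + 1     ≡⟨ solve (n ∷ w ∷ []) ⟩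
  2 * (n + 1) + (w + 1)   ∎)

cancel-cube : ∀ n w → (n + 1) * (n + 1) * (n + 1) + 3 * (n + 1) ≡ w + (3 * ((n + 1) * (n + 1)) + 2) → n ^ 3 ≡ w + 1
cancel-cube n w e = +-cancelˡ-≡ (3 * ((n + 1) * (n + 1)) + 1) (n ^ 3) (w + 1) (begin
  3 * ((n + 1) * (n + 1)) + 1 + n * (n * (n * 1))     ≡⟨ solve (n ∷ []) ⟩
  (n + 1) * (n + 1) * (n + 1) + 3 * (n + 1)           ≡⟨ e ⟩
  w + (3 * ((n + 1) * (n + 1)) + 2)                   ≡⟨ solve (n ∷ w ∷ []) ⟩
  3 * ((n + 1) * (n + 1)) + 1 + (w + 1)               ∎)

7^<lucas : ∀ h → 7 ^ h < lucas ((3 * h + 1) + (3 * h + 1))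
7^<lucas h = <-≤-trans 7^h<2^[3h+1] (2^≤lucas (3 * h + 1))
  where
  7^h≤2^3h : 7 ^ h ≤ 2 ^ (3 * h)
  7^h≤2^3h = ≤-trans (^-monoˡ-≤ h (n≤1+n 7)) (≤-reflexive (^-*-assoc 2 3 h))
  7^h<2^[3h+1] : 7 ^ h < 2 ^ (3 * h + 1)
  7^h<2^[3h+1] = ≤-<-trans 7^h≤2^3h (^-monoʳ-< 2 ≤-refl (≤-reflexive (+-comm 1 (3 * h))))

cost-bound : ∀ h → 1 ≤ h → 3 * h * ((3 * h + 1) * 8 + 2) + ((3 * h + 1) * 4 + 1) ≤ 130 * (h * h)
cost-bound (suc h) _ = ≤-trans (m≤m+n _ (58 * h * h + 74 * h + 11)) (≤-reflexive (arith h))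
  where
  arith : ∀ h → 3 * (1 + h) * ((3 * (1 + h) + 1) * 8 + 2) + ((3 * (1 + h) + 1) * 4 + 1)
                  + (58 * h * h + 74 * h + 11) ≡ 130 * ((1 + h) * (1 + h))
  arith = solve-∀

module LucasMultiples (q : ℕ) where

  k : ℕ
  k = q + q

  ℓ : ℕ → ℕ
  ℓ j = lucas (k * j)

  ℓ-0 : ℓ 0 ≡ 2
  ℓ-0 rewrite *-zeroʳ k = lucas-0

  ℓ-*-≤ : ∀ {i j} → j ≤ i → ℓ j * ℓ i ≡ ℓ (i + j) + ℓ (i ∸ j)
  ℓ-*-≤ {i} {j} j≤i = begin
    lucas (k * j) * ℓ i                             ≡⟨ cong (λ u → lucas u * ℓ i) (*-distribʳ-+ j q q) ⟩
    lucas (q * j + q * j) * ℓ i                     ≡⟨ lucas-*-even (q * j) (k * i) kj≤ki ⟩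
    lucas (k * i + (q * j + q * j)) + lucas (k * i ∸ (q * j + q * j))
      ≡⟨ cong₂ (λ u v → lucas (k * i + u) + lucas (k * i ∸ v)) kj kj ⟩
    lucas (k * i + k * j) + lucas (k * i ∸ k * j)
      ≡⟨ cong₂ (λ u v → lucas u + lucas v) (sym (*-distribˡ-+ k i j)) (sym (*-distribˡ-∸ k i j)) ⟩
    ℓ (i + j) + ℓ (i ∸ j)                           ∎
    where
    kj : q * j + q * j ≡ k * j
    kj = sym (*-distribʳ-+ j q q)
    kj≤ki : q * j + q * j ≤ k * i
    kj≤ki = subst (_≤ k * i) (sym kj) (*-monoʳ-≤ k j≤i)

  ℓ-* : ∀ i j → ℓ i * ℓ j ≡ ℓ (i + j) + ℓ ∣ i - j ∣
  ℓ-* i j with ≤-total j i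
  ... | inj₁ j≤i = begin
    ℓ i * ℓ j                 ≡⟨ *-comm (ℓ i) (ℓ j) ⟩
    ℓ j * ℓ i                 ≡⟨ ℓ-*-≤ j≤i ⟩
    ℓ (i + j) + ℓ (i ∸ j)     ≡⟨ cong (λ u → ℓ (i + j) + ℓ u) (sym (m≤n⇒∣n-m∣≡n∸m j≤i)) ⟩
    ℓ (i + j) + ℓ ∣ i - j ∣   ∎
  ... | inj₂ i≤j = begin
    ℓ i * ℓ j                 ≡⟨ ℓ-*-≤ i≤j ⟩
    ℓ (j + i) + ℓ (j ∸ i)     ≡⟨ cong₂ (λ u v → ℓ u + ℓ v) (+-comm j i) (sym (m≤n⇒∣m-n∣≡n∸m i≤j)) ⟩
    ℓ (i + j) + ℓ ∣ i - j ∣   ∎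

  Σℓ : List ℕ → ℕ
  Σℓ M = sum (map ℓ M)

  ⟦_⟧ : LucasPoly → ℕ
  ⟦ M , c ⟧ = Σℓ M + c

  Σℓ-++ : ∀ xs ys → Σℓ (xs ++ ys) ≡ Σℓ xs + Σℓ ys
  Σℓ-++ xs ys = trans (cong sum (map-++ ℓ xs ys)) (sum-++ (map ℓ xs) (map ℓ ys))

  Σℓ-⊙ : ∀ x ys → Σℓ (x ⊙ ys) ≡ ℓ x * Σℓ ys
  Σℓ-⊙ x [] = sym (*-zeroʳ (ℓ x))
  Σℓ-⊙ x (y ∷ ys) = begin
    ℓ (x + y) + (ℓ ∣ x - y ∣ + Σℓ (x ⊙ ys)) ≡⟨ sym (+-assoc (ℓ (x + y)) _ _) ⟩
    ℓ (x + y) + ℓ ∣ x - y ∣ + Σℓ (x ⊙ ys)   ≡⟨ cong₂ _+_ (sym (ℓ-* x y)) (Σℓ-⊙ x ys) ⟩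
    ℓ x * ℓ y + ℓ x * Σℓ ys                 ≡⟨ sym (*-distribˡ-+ (ℓ x) (ℓ y) (Σℓ ys)) ⟩
    ℓ x * (ℓ y + Σℓ ys)                     ∎

  Σℓ-⊠ : ∀ xs ys → Σℓ (xs ⊠ ys) ≡ Σℓ xs * Σℓ ys
  Σℓ-⊠ [] ys = refl
  Σℓ-⊠ (x ∷ xs) ys rewrite Σℓ-++ (x ⊙ ys) (xs ⊠ ys) | Σℓ-⊙ x ys | Σℓ-⊠ xs ys =
    sym (*-distribʳ-+ (Σℓ ys) (ℓ x) (Σℓ xs))

  Σℓ-copies : ∀ c M → Σℓ (copies c M) ≡ c * Σℓ M
  Σℓ-copies zero M = refl
  Σℓ-copies (suc c) M rewrite Σℓ-++ M (copies c M) | Σℓ-copies c M = refl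

  ⟦⊗⟧ : ∀ p p′ → ⟦ p ⊗ p′ ⟧ ≡ ⟦ p ⟧ * ⟦ p′ ⟧
  ⟦⊗⟧ (M , c) (M′ , c′)
    rewrite Σℓ-++ (M ⊠ M′) (copies c′ M ++ copies c M′) | Σℓ-++ (copies c′ M) (copies c M′)
          | Σℓ-⊠ M M′ | Σℓ-copies c′ M | Σℓ-copies c M′ = arith (Σℓ M) (Σℓ M′) c c′
    where
    arith : ∀ a b c c′ → a * b + (c′ * a + c * b) + c * c′ ≡ (a + c) * (b + c′)
    arith = solve-∀

  Σℓ-by-multiplicities : ∀ D {M} → All (_≤ D) M → Σℓ M ≡ sumUpTo (λ j → multiplicity j M * ℓ j) D
  Σℓ-by-multiplicities D {[]} All.[] = sym (sumUpTo-zero D)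
    where
    sumUpTo-zero : ∀ D → sumUpTo (λ _ → 0) D ≡ 0
    sumUpTo-zero zero = refl
    sumUpTo-zero (suc D) rewrite sumUpTo-zero D = refl
  Σℓ-by-multiplicities D {x ∷ xs} (x≤D All.∷ xs≤D) = begin
    ℓ x + Σℓ xs
      ≡⟨ cong₂ _+_ (sym (sumUpTo-δ ℓ D x≤D)) (Σℓ-by-multiplicities D xs≤D) ⟩
    sumUpTo (λ j → δ j x * ℓ j) D + sumUpTo (λ j → multiplicity j xs * ℓ j) D
      ≡⟨ sym (sumUpTo-+ _ _ D) ⟩
    sumUpTo (λ j → δ j x * ℓ j + multiplicity j xs * ℓ j) D
      ≡⟨ sumUpTo-cong D (λ j → sym (*-distribʳ-+ (ℓ j) (δ j x) _)) ⟩
    sumUpTo (λ j → (δ j x + multiplicity j xs) * ℓ j) D ∎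

  -- On closed lists the two multiplicity sums agree definitionally, so the last argument is refl.
  Σℓ-by-expansion : ∀ D M M′ → True (All.all? (_≤? D) M) → True (All.all? (_≤? D) M′) →
                    sumUpTo (λ j → multiplicity j M * ℓ j) D ≡ sumUpTo (λ j → multiplicity j M′ * ℓ j) D →
                    Σℓ M ≡ Σℓ M′
  Σℓ-by-expansion D M M′ M≤D M′≤D e =
    trans (Σℓ-by-multiplicities D (toWitness M≤D)) (trans e (sym (Σℓ-by-multiplicities D (toWitness M′≤D))))

  square-identity : Σℓ (base ⊠ base) ≡ Σℓ (square-terms ++ copies 2 base)
  square-identity = Σℓ-by-expansion 6 (base ⊠ base) (square-terms ++ copies 2 base) tt tt refl

  cube-identity : Σℓ ((base ⊠ base) ⊠ base ++ copies 3 base) ≡ Σℓ (cube-terms ++ copies 3 (base ⊠ base) ++ 0 ∷ [])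
  cube-identity =
    Σℓ-by-expansion 9 ((base ⊠ base) ⊠ base ++ copies 3 base) (cube-terms ++ copies 3 (base ⊠ base) ++ 0 ∷ [])
      tt tt refl

  module _ (n : ℕ) (n+1≡base : n + 1 ≡ Σℓ base) where

    ⟦square⟧ : ⟦ power 0 ⟧ ≡ n ^ 2
    ⟦square⟧ = sym (cancel-square n (Σℓ square-terms) (begin
      (n + 1) * (n + 1)                  ≡⟨ cong₂ _*_ n+1≡base n+1≡base ⟩
      Σℓ base * Σℓ base                  ≡⟨ sym (Σℓ-⊠ base base) ⟩
      Σℓ (base ⊠ base)                   ≡⟨ square-identity ⟩
      Σℓ (square-terms ++ copies 2 base) ≡⟨ Σℓ-++ square-terms (copies 2 base) ⟩
      Σℓ square-terms + Σℓ (copies 2 base) ≡⟨ cong (Σℓ square-terms +_) (Σℓ-copies 2 base) ⟩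
      Σℓ square-terms + 2 * Σℓ base      ≡⟨ cong (λ s → Σℓ square-terms + 2 * s) (sym n+1≡base) ⟩
      Σℓ square-terms + 2 * (n + 1)      ∎))

    ⟦cube⟧ : ⟦ power 1 ⟧ ≡ n ^ 3
    ⟦cube⟧ = sym (cancel-cube n (Σℓ cube-terms) (begin
      s * s * s + 3 * s
        ≡⟨ cong₂ (λ u v → u * v * v + 3 * v) n+1≡base n+1≡base ⟩
      Σℓ base * Σℓ base * Σℓ base + 3 * Σℓ base
        ≡⟨ cong₂ (λ u v → u * Σℓ base + v) (sym (Σℓ-⊠ base base)) (sym (Σℓ-copies 3 base)) ⟩
      Σℓ (base ⊠ base) * Σℓ base + Σℓ (copies 3 base)
        ≡⟨ cong (_+ Σℓ (copies 3 base)) (sym (Σℓ-⊠ (base ⊠ base) base)) ⟩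
      Σℓ ((base ⊠ base) ⊠ base) + Σℓ (copies 3 base)
        ≡⟨ sym (Σℓ-++ ((base ⊠ base) ⊠ base) (copies 3 base)) ⟩
      Σℓ ((base ⊠ base) ⊠ base ++ copies 3 base)
        ≡⟨ cube-identity ⟩
      Σℓ (cube-terms ++ copies 3 (base ⊠ base) ++ 0 ∷ [])
        ≡⟨ Σℓ-++ cube-terms (copies 3 (base ⊠ base) ++ 0 ∷ []) ⟩
      Σℓ cube-terms + Σℓ (copies 3 (base ⊠ base) ++ 0 ∷ [])
        ≡⟨ cong (Σℓ cube-terms +_) (Σℓ-++ (copies 3 (base ⊠ base)) (0 ∷ [])) ⟩
      Σℓ cube-terms + (Σℓ (copies 3 (base ⊠ base)) + (ℓ 0 + 0))
        ≡⟨ cong₂ (λ u v → Σℓ cube-terms + (u + (v + 0))) (Σℓ-copies 3 (base ⊠ base)) ℓ-0 ⟩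
      Σℓ cube-terms + (3 * Σℓ (base ⊠ base) + 2)
        ≡⟨ cong (λ u → Σℓ cube-terms + (3 * u + 2)) (trans (Σℓ-⊠ base base) (cong₂ _*_ (sym n+1≡base) (sym n+1≡base))) ⟩
      Σℓ cube-terms + (3 * (s * s) + 2) ∎))
      where s = n + 1

    ⟦power⟧ : ∀ h → ⟦ power h ⟧ ≡ n ^ (2 + h)
    ⟦power⟧ zero = ⟦square⟧
    ⟦power⟧ (suc zero) = ⟦cube⟧
    ⟦power⟧ (suc (suc h)) = begin
      ⟦ power 0 ⊗ power h ⟧       ≡⟨ ⟦⊗⟧ (power 0) (power h) ⟩
      ⟦ power 0 ⟧ * ⟦ power h ⟧   ≡⟨ cong₂ _*_ ⟦square⟧ (⟦power⟧ h) ⟩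
      n ^ 2 * n ^ (2 + h)         ≡⟨ sym (^-distribˡ-+-* n 2 (2 + h)) ⟩
      n ^ (4 + h)                 ∎

  fibSum-⟦⟧ : ∀ i D {M c} → i ≤ q → All (_≤ D) M → size (M , c) < lucas (i + i) →
              FibSumAtMost (D * (i * 8 + 2) + (i * 4 + 1)) ⟦ M , c ⟧
  fibSum-⟦⟧ i D {M} {c} i≤q M≤D size<L =
    subst (FibSumAtMost _) (cong (_+ c) (sym (Σℓ-by-multiplicities D M≤D)))
      (fibSum-sumUpTo (λ j → multiplicity j M * ℓ j) D constant terms)
    where
    length≤size : length M ≤ size (M , c)
    length≤size = ≤-trans (m≤m+n (length M) (length M + 0)) (m≤m+n _ c)
    constant : FibSumAtMost (i * 4 + 1) (multiplicity 0 M * ℓ 0 + c)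
    constant = subst (λ x → FibSumAtMost _ (multiplicity 0 M * x + c)) (sym ℓ-0)
      (fibSum-< i _ (≤-<-trans (+-monoˡ-≤ c m₀*2≤) size<L))
      where
      m₀*2≤ : multiplicity 0 M * 2 ≤ 2 * length M
      m₀*2≤ = ≤-trans (≤-reflexive (*-comm (multiplicity 0 M) 2)) (*-monoʳ-≤ 2 (multiplicity≤length 0 M))
    terms : ∀ j → FibSumAtMost (i * 8 + 2) (multiplicity (suc j) M * ℓ (suc j))
    terms j = fibSum-*lucas i (k * suc j) (≤-trans (+-mono-≤ i≤q i≤q) (m≤m*n k (suc j))) _
                (≤-<-trans (≤-trans (multiplicity≤length (suc j) M) length≤size) size<L)

  fibSum-power : ∀ n → n + 1 ≡ Σℓ base → ∀ h → 3 * (2 + h) + 1 ≤ q →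
                 FibSumAtMost (130 * ((2 + h) * (2 + h))) (n ^ (2 + h))
  fibSum-power n n+1≡base h i≤q =
    subst (FibSumAtMost _) (⟦power⟧ n n+1≡base h)
      (fibSum-mono (cost-bound (2 + h) (s≤s z≤n))
        (fibSum-⟦⟧ i (3 * (2 + h)) i≤q (power-bounded h)
          (subst (_< lucas (i + i)) (sym (size-power h)) (7^<lucas (2 + h)))))
    where i = 3 * (2 + h) + 1

-- The Zeckendorf witness

fib-telescope : ∀ a n → fib (1 + a) + sum (map fib (iterate (2 +_) (2 + a) n)) ≡ fib (1 + a + (n + n))
fib-telescope a zero = trans (+-identityʳ (fib (1 + a))) (cong fib (sym (+-identityʳ (1 + a))))
fib-telescope a (suc n) = begin
  fib (1 + a) + (fib (2 + a) + rest)   ≡⟨ sym (+-assoc (fib (1 + a)) (fib (2 + a)) rest) ⟩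
  fib (1 + a) + fib (2 + a) + rest     ≡⟨ cong (_+ rest) (+-comm (fib (1 + a)) (fib (2 + a))) ⟩
  fib (3 + a) + rest                   ≡⟨ fib-telescope (2 + a) n ⟩
  fib (3 + a + (n + n))                ≡⟨ cong fib (arith a n) ⟩
  fib (1 + a + (suc n + suc n))        ∎
  where
  rest = sum (map fib (iterate (2 +_) (4 + a) n))
  arith : ∀ a n → 3 + a + (n + n) ≡ 1 + a + (suc n + suc n)
  arith = solve-∀

iterate-bounded : ∀ {b} a n → b ≤ a → All (b ≤_) (iterate (2 +_) a n)
iterate-bounded a zero _ = All.[]
iterate-bounded a (suc n) b≤a = b≤a All.∷ iterate-bounded (2 + a) n (≤-trans b≤a (m≤n+m a 2))

iterate-++-linked : ∀ a n {y ys} → a + (n + n) ≤ y → Linked NonAdj (y ∷ ys) → Linked NonAdj (iterate (2 +_) a n ++ y ∷ ys)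
iterate-++-linked a zero _ y∷ys = y∷ys
iterate-++-linked a (suc zero) a+2≤y y∷ys = ≤-trans (≤-reflexive (+-comm 2 a)) a+2≤y Linked.∷ y∷ys
iterate-++-linked a (suc (suc n)) a+2n≤y y∷ys =
  ≤-refl Linked.∷ iterate-++-linked (2 + a) (suc n) (≤-trans (≤-reflexive (arith a n)) a+2n≤y) y∷ys
  where
  arith : ∀ a n → 2 + a + (suc n + suc n) ≡ a + (suc (suc n) + suc (suc n))
  arith = solve-∀

fib-+6 : ∀ x → fib x + fib (6 + x) ≡ lucas (3 + x) + lucas (3 + x)
fib-+6 x rewrite lucas-suc (2 + x) with fib x | fib (suc x)
... | a | b = solve (a ∷ b ∷ [])

-- n = F_2 + F_4 + … + F_{2p+2} + F_{2p+9} + F_{4p+11} + F_{4p+13} + F_{6p+17} + F_{6p+19} has p + 6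
-- non-adjacent terms, and with k = 2p + 6 the telescoping sum and fib-+6 give
-- n + 1 = 2 L_k + L_{2k} + L_{3k} = Σℓ base.
module ZeckendorfWitness (p : ℕ) where

  open LucasMultiples (3 + p) using (ℓ; Σℓ)

  P = p + p

  tail : List ℕ
  tail = 9 + P ∷ 11 + (P + P) ∷ 13 + (P + P) ∷ 17 + (P + (P + P)) ∷ 19 + (P + (P + P)) ∷ []

  indices : List ℕ
  indices = iterate (2 +_) 2 (suc p) ++ tail

  indices-≥2 : All (2 ≤_) indices
  indices-≥2 = ++⁺ (iterate-bounded 2 (suc p) ≤-refl) (2≤ All.∷ 2≤ All.∷ 2≤ All.∷ 2≤ All.∷ 2≤ All.∷ All.[])
    where
    2≤ : ∀ {m} → 2 ≤ 2 + m
    2≤ = s≤s (s≤s z≤n)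

  indices-linked : Linked NonAdj indices
  indices-linked = iterate-++-linked 2 (suc p) (≤-trans (≤-reflexive (arith p)) (+-monoˡ-≤ P (m≤m+n 4 5))) tail-linked
    where
    arith : ∀ p → 2 + (suc p + suc p) ≡ 4 + (p + p)
    arith = solve-∀
    tail-linked : Linked NonAdj tail
    tail-linked =
      +-monoʳ-≤ 11 (m≤m+n P P) Linked.∷ ≤-refl Linked.∷
      +-mono-≤ (m≤m+n 15 2) (m≤n+m (P + P) P) Linked.∷
      ≤-refl Linked.∷ Linked.[-]

  length-indices : length indices ≡ p + 6
  length-indices = begin
    length (iterate (2 +_) 2 (suc p) ++ tail)   ≡⟨ length-++ (iterate (2 +_) 2 (suc p)) ⟩
    length (iterate (2 +_) 2 (suc p)) + 5       ≡⟨ cong (_+ 5) (length-iterate (2 +_) 2 (suc p)) ⟩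
    suc p + 5                                   ≡⟨ sym (+-suc p 5) ⟩
    p + 6                                       ∎

  sum-indices : sum (map fib indices) + 1 ≡ Σℓ base
  sum-indices = begin
    sum (map fib indices) + 1
      ≡⟨ cong (_+ 1) (trans (cong sum (map-++ fib evens tail)) (sum-++ (map fib evens) (map fib tail))) ⟩
    sum (map fib evens) + sum (map fib tail) + 1
      ≡⟨ arith₁ (sum (map fib evens)) (sum (map fib tail)) ⟩
    fib 1 + sum (map fib evens) + sum (map fib tail)
      ≡⟨ cong (_+ sum (map fib tail)) (trans (fib-telescope 0 (suc p)) (cong fib (arith₂ p))) ⟩
    fib (3 + P) + sum (map fib tail)
      ≡⟨ arith₃ (fib (3 + P)) (fib (9 + P)) (fib (11 + (P + P))) (fib (13 + (P + P)))
                (fib (17 + (P + (P + P)))) (fib (19 + (P + (P + P)))) ⟩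
    (fib (17 + (P + (P + P))) + fib (19 + (P + (P + P))))
      + ((fib (11 + (P + P)) + fib (13 + (P + P))) + (fib (3 + P) + fib (9 + P)))
      ≡⟨ cong₂ (λ u v → u + (v + (fib (3 + P) + fib (9 + P))))
               (sym (lucas-suc (17 + (P + (P + P))))) (sym (lucas-suc (11 + (P + P)))) ⟩
    lucas (18 + (P + (P + P))) + (lucas (12 + (P + P)) + (fib (3 + P) + fib (9 + P)))
      ≡⟨ cong (λ u → lucas (18 + (P + (P + P))) + (lucas (12 + (P + P)) + u)) (fib-+6 (3 + P)) ⟩
    lucas (18 + (P + (P + P))) + (lucas (12 + (P + P)) + (lucas (6 + P) + lucas (6 + P)))
      ≡⟨ cong₂ (λ u v → lucas u + (lucas v + (lucas (6 + P) + lucas (6 + P)))) (sym (k*3 p)) (sym (k*2 p)) ⟩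
    ℓ 3 + (ℓ 2 + (lucas (6 + P) + lucas (6 + P)))
      ≡⟨ cong (λ u → ℓ 3 + (ℓ 2 + u)) (cong₂ _+_ ℓ₁ (trans ℓ₁ (sym (+-identityʳ (ℓ 1))))) ⟩
    Σℓ base ∎
    where
    evens = iterate (2 +_) 2 (suc p)
    arith₁ : ∀ a b → a + b + 1 ≡ 1 + a + b
    arith₁ = solve-∀
    arith₂ : ∀ p → 1 + (suc p + suc p) ≡ 3 + (p + p)
    arith₂ = solve-∀
    arith₃ : ∀ a b c d e f → a + (b + (c + (d + (e + (f + 0))))) ≡ (e + f) + ((c + d) + (a + b))
    arith₃ = solve-∀
    ℓ₁ : lucas (6 + P) ≡ ℓ 1
    ℓ₁ = cong lucas (sym (k*1 p))
      where
      k*1 : ∀ p → (3 + p + (3 + p)) * 1 ≡ 6 + (p + p)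
      k*1 = solve-∀
    k*2 : ∀ p → (3 + p + (3 + p)) * 2 ≡ 12 + ((p + p) + (p + p))
    k*2 = solve-∀
    k*3 : ∀ p → (3 + p + (3 + p)) * 3 ≡ 18 + ((p + p) + ((p + p) + (p + p)))
    k*3 = solve-∀

theorem2 : (h : ℕ) → 2 ≤ h → Σ ℕ λ N₀ → (N : ℕ) → N₀ < N → Σ ℕ λ n → 1 ≤ n × ZeckSumOf N n × FibSumAtMost (130 * (h * h)) (n ^ h)
theorem2 (suc zero) (s≤s ())
theorem2 (suc (suc h)) _ = 3 * (2 + h) + 5 , witness
  where
  witness : (N : ℕ) → 3 * (2 + h) + 5 < N →
            Σ ℕ λ n → 1 ≤ n × ZeckSumOf N n × FibSumAtMost (130 * ((2 + h) * (2 + h))) (n ^ (2 + h))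
  witness N N₀<N with m≤n⇒∃[o]m+o≡n N₀<N
  ... | o , refl =
    sum (map fib indices) , s≤s z≤n ,
    (indices , indices-≥2 , indices-linked , trans length-indices (length≡ h o) , refl) ,
    LucasMultiples.fibSum-power (3 + p) (sum (map fib indices)) sum-indices h (i≤q h o)
    where
    p = 3 * (2 + h) + o
    open ZeckendorfWitness p
    length≡ : ∀ h o → 3 * (2 + h) + o + 6 ≡ suc (3 * (2 + h) + 5 + o)
    length≡ = solve-∀
    i≤q : ∀ h o → 3 * (2 + h) + 1 ≤ 3 + (3 * (2 + h) + o)
    i≤q h o = ≤-trans (m≤m+n (3 * (2 + h) + 1) (2 + o)) (≤-reflexive (arith h o))
      where
      arith : ∀ h o → 3 * (2 + h) + 1 + (2 + o) ≡ 3 + (3 * (2 + h) + o)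
      arith = solve-∀
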